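{- Let $v\ge4$. As formal power series in $y$, \[1+\sum_{d=1}^\infty \sum_{D \in \mathcal{D}_{v,d}(231,312)} x^{des(\pi_D)}y^d = \frac{1+x-yx(1+x)^{v-2}}{(1+x)\left(1-y(1+x)^{v-2}\right)}.\]
   Context: A diamond with $v$ vertices ($v\ge4$) is the poset with a least element, a greatest element, and $v-2$ pairwise incomparable middle elements (in a fixed left-to-right order) strictly between them. $\mathcal{D}_{v,d}$ is the set of labellings of $d$ diamonds (placed left to right) by $1,\dots,vd$, each label used once, such that in each diamond least label $<$ each middle label $<$ greatest label. For $D\in\mathcal{D}_{v,d}$, $\pi_D$ is the permutation obtained by reading the diamonds left to right and, within each diamond, the least element, then the middle elements left to right, then the greatest element. $\mathcal{D}_{v,d}(P)$ is the set of $D$ with $\pi_D$ avoiding every classical pattern in $P$. $des(\pi)$ is the number of $i$ with $\pi_i>\pi_{i+1}$. -}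

module Defs where

open import Data.Bool using (Bool; true; false; _∧_; _∨_; not; if_then_else_)
open import Data.Nat as ℕ using (ℕ; zero; suc; _*_; _<ᵇ_)
open import Data.Integer as ℤ using (ℤ; +_; _^_) renaming (_+_ to _+ℤ_; _*_ to _*ℤ_; -_ to -ℤ_)
open import Data.List using (List; []; _∷_; map; concat; concatMap; filter; upTo; length; take; drop; sum; foldr)
open import Data.Bool.ListAction using (and; or)
open import Relation.Nullary.Decidable using (does)
open import Data.Bool.Properties using (T?)

insertions : ℕ → List ℕ → List (List ℕ)
insertions a []       = (a ∷ []) ∷ []
insertions a (b ∷ bs) = (a ∷ b ∷ bs) ∷ map (b ∷_) (insertions a bs)

perms : List ℕ → List (List ℕ)
perms []       = [] ∷ []
perms (a ∷ as) = concatMap (insertions a) (perms as)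

-- Diamonds: a labelled diamond with v vertices is the list of its labels
-- in reading order: least, middle elements left to right, greatest.
-- A labelling of d diamonds is a list of d such blocks.

blocks : ℕ → ℕ → List ℕ → List (List ℕ)
blocks v zero    xs = []
blocks v (suc d) xs = take v xs ∷ blocks v d (drop v xs)

lastOr : ℕ → List ℕ → ℕ
lastOr a []       = a
lastOr a (b ∷ bs) = lastOr b bs

initL : List ℕ → List ℕ
initL []           = []
initL (a ∷ [])     = []
initL (a ∷ b ∷ bs) = a ∷ initL (b ∷ bs)

validDiamond : List ℕ → Bool
validDiamond []       = false
validDiamond (lo ∷ rest) =
  and (map (λ m → (lo <ᵇ m) ∧ (m <ᵇ lastOr lo rest)) (initL rest))
  ∧ (lo <ᵇ lastOr lo rest)

𝒟 : ℕ → ℕ → List (List (List ℕ))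
𝒟 v d = filter (λ D → T? (and (map validDiamond D)))
               (map (blocks v d) (perms (map suc (upTo (v * d)))))

πD : List (List ℕ) → List ℕ
πD = concat

subseqs : List ℕ → List (List ℕ)
subseqs []       = [] ∷ []
subseqs (a ∷ as) = map (a ∷_) (subseqs as) Data.List.++ subseqs as

-- order-isomorphism of two sequences: same length and
-- for all positions i, j : a_i < a_j  iff  b_i < b_j
pairsAgree : List ℕ → List ℕ → Bool
pairsAgree [] []             = true
pairsAgree (a ∷ as) (b ∷ bs) =
  and (zipB a b as bs) ∧ pairsAgree as bs
  where
  eqB : Bool → Bool → Bool
  eqB true  true  = true
  eqB false false = true
  eqB _     _     = false
  zipB : ℕ → ℕ → List ℕ → List ℕ → List Bool
  zipB a b (c ∷ cs) (e ∷ es) = (eqB (a <ᵇ c) (b <ᵇ e) ∧ eqB (c <ᵇ a) (e <ᵇ b)) ∷ zipB a b cs es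
  zipB a b _ _ = []
pairsAgree _ _ = false

contains : List ℕ → List ℕ → Bool
contains p π = or (map (pairsAgree p) (subseqs π))

avoidsAll : List (List ℕ) → List ℕ → Bool
avoidsAll P π = and (map (λ p → not (contains p π)) P)

𝒟P : ℕ → ℕ → List (List ℕ) → List (List (List ℕ))
𝒟P v d P = filter (λ D → T? (avoidsAll P (πD D))) (𝒟 v d)

des : List ℕ → ℕ
des []           = 0
des (a ∷ [])     = 0
des (a ∷ b ∷ bs) = (if b <ᵇ a then 1 else 0) ℕ.+ des (b ∷ bs)

-- Formal power series in y with integer coefficients (the variable x
-- is evaluated at an arbitrary integer).

Series : Set
Series = ℕ → ℤ

constS : ℤ → Series
constS c zero    = c
constS c (suc n) = + 0

Y : Series
Y (suc zero) = + 1
Y _          = + 0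

_⊕_ : Series → Series → Series
(f ⊕ g) n = f n +ℤ g n

⊖_ : Series → Series
(⊖ f) n = -ℤ (f n)

_⊖_ : Series → Series → Series
f ⊖ g = f ⊕ (⊖ g)

_⊛_ : Series → Series → Series
(f ⊛ g) n = foldr _+ℤ_ (+ 0) (map (λ k → f k *ℤ g (n ℕ.∸ k)) (upTo (suc n)))

infixl 6 _⊕_ _⊖_
infixl 7 _⊛_

pat231 pat312 : List ℕ
pat231 = 2 ∷ 3 ∷ 1 ∷ []
pat312 = 3 ∷ 1 ∷ 2 ∷ []

GF : ℕ → ℤ → Series
GF v x zero    = + 1
GF v x (suc d) =
  foldr _+ℤ_ (+ 0)
    (map (λ D → x ^ des (πD D)) (𝒟P v (suc d) (pat231 ∷ pat312 ∷ [])))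

-- A permutation avoids 231 and 312 exactly when it is layered: a concatenation of
-- decreasing blocks, each lying entirely below the next. Inserting the minimum into a
-- layered permutation keeps it avoiding only at the front or at the end of the first
-- block, so the layered permutations of 1, …, N correspond to their descent words in
-- {0,1}^(N-1). In a layered permutation every ascent separates all earlier from all
-- later entries, so π_D satisfies the diamond conditions iff the steps out of each least
-- and into each greatest element are ascents, the other (v-2)d - 1 steps being free.
-- Hence the coefficient of y^d is (1+x)^((v-2)d-1) for d ≥ 1, a geometric sequence of
-- ratio (1+x)^(v-2), and clearing the denominator leaves an identity between the first
-- two coefficients.

module Submission where

open import Defs
open import Data.Nat using (ℕ; _≤_; _∸_)
open import Data.Integer using (ℤ; +_; _+_; _*_; _^_; -_)
open import Relation.Binary.PropositionalEquality using (_≡_)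

open import Data.Bool using (Bool; true; false; _∧_; _∨_; not; T; if_then_else_)
open import Data.Bool.ListAction using (and)
open import Data.Bool.Properties using (T?; T-∧; ∧-assoc; ∧-identityʳ)
open import Data.Empty using (⊥-elim)
import Data.Integer.Properties as ℤ
open import Data.Integer.Tactic.RingSolver using (solve-∀)
open import Data.List using (List; []; _∷_; _++_; map; length; filter; concat; concatMap; take; drop; replicate; foldr; upTo; applyUpTo)
import Data.List.Properties as List
open import Data.List.Membership.Propositional using (_∈_; find; lose)
import Data.List.Membership.Propositional.Properties as ∈
open import Data.List.Relation.Binary.Sublist.Propositional using (_⊆_; []; _∷_; _∷ʳ_; ⊆-refl; ⊆-trans; minimum; from∈)
open import Data.List.Relation.Binary.Sublist.Propositional.Properties using (All-resp-⊆; ++⁺ˡ)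
open import Data.List.Relation.Unary.All as All using (All; []; _∷_)
import Data.List.Relation.Unary.All.Properties as All
open import Data.List.Relation.Unary.AllPairs using (AllPairs; []; _∷_)
import Data.List.Relation.Unary.AllPairs.Properties as AllPairs
open import Data.List.Relation.Unary.Any using (here; there)
open import Data.List.Relation.Unary.Any.Properties using (any⁺; any⁻)
open import Data.Nat as ℕ using (zero; suc; _<_; _>_; _<ᵇ_; s≤s)
import Data.Nat.Properties as ℕ
open import Data.Product using (∃-syntax; _×_; _,_; proj₁; proj₂)
open import Data.Sum using (_⊎_; inj₁; inj₂)
open import Data.Unit using (tt)
open import Function using (case_of_; _∘_; id)
open import Function.Bundles using (module Equivalence)
open Equivalence using (to; from)
open import Level using (0ℓ)
open import Relation.Binary.PropositionalEquality using (refl; sym; trans; subst; cong; cong₂; module ≡-Reasoning)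
open import Relation.Nullary using (¬_; yes; no)
open import Relation.Nullary.Decidable using (decidable-stable)
open import Relation.Unary using (Pred; Decidable)

-- Pattern occurrences

<ᵇ≡true⇒< : ∀ {m n} → (m <ᵇ n) ≡ true → m < n
<ᵇ≡true⇒< {m} {n} eq = ℕ.<ᵇ⇒< m n (subst T (sym eq) tt)

<⇒<ᵇ≡true : ∀ {m n} → m < n → (m <ᵇ n) ≡ true
<⇒<ᵇ≡true {m} {n} m<n with m <ᵇ n | ℕ.<⇒<ᵇ m<n
... | true | _ = refl

<⇒>ᵇ≡false : ∀ {m n} → m < n → (n <ᵇ m) ≡ false
<⇒>ᵇ≡false {m} {n} m<n with n <ᵇ m in eq
... | false = refl
... | true = ⊥-elim (ℕ.<-asym m<n (<ᵇ≡true⇒< eq))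

T⇔T⇒≡ : ∀ {x y} → (T x → T y) → (T y → T x) → x ≡ y
T⇔T⇒≡ {false} {false} _ _ = refl
T⇔T⇒≡ {false} {true}  _ y⇒x = ⊥-elim (y⇒x tt)
T⇔T⇒≡ {true}  {false} x⇒y _ = ⊥-elim (x⇒y tt)
T⇔T⇒≡ {true}  {true}  _ _ = refl

T-not-<ᵇ⇒≮ : ∀ {m n} → T (not (m <ᵇ n)) → ¬ m < n
T-not-<ᵇ⇒≮ m≮n m<n rewrite <⇒<ᵇ≡true m<n = m≮n

∈-subseqs⇒⊆ : ∀ {s} σ → s ∈ subseqs σ → s ⊆ σ
∈-subseqs⇒⊆ [] (here refl) = []
∈-subseqs⇒⊆ (a ∷ σ) s∈ with ∈.∈-++⁻ (map (a ∷_) (subseqs σ)) s∈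
... | inj₂ s∈σ = a ∷ʳ ∈-subseqs⇒⊆ σ s∈σ
... | inj₁ s∈aσ with ∈.∈-map⁻ (a ∷_) s∈aσ
...   | _ , s∈σ , refl = refl ∷ ∈-subseqs⇒⊆ σ s∈σ

⊆⇒∈-subseqs : ∀ {s σ} → s ⊆ σ → s ∈ subseqs σ
⊆⇒∈-subseqs [] = here refl
⊆⇒∈-subseqs (_∷ʳ_ {ys = σ} a p) = ∈.∈-++⁺ʳ (map (a ∷_) (subseqs σ)) (⊆⇒∈-subseqs p)
⊆⇒∈-subseqs (refl ∷ p) = ∈.∈-++⁺ˡ (∈.∈-map⁺ _ (⊆⇒∈-subseqs p))

contains⇒sublist : ∀ p σ → T (contains p σ) → ∃[ s ] s ⊆ σ × T (pairsAgree p s)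
contains⇒sublist p σ c with find (any⁻ (pairsAgree p) (subseqs σ) c)
... | s , s∈ , agree = s , ∈-subseqs⇒⊆ σ s∈ , agree

sublist⇒contains : ∀ p {s σ} → s ⊆ σ → T (pairsAgree p s) → T (contains p σ)
sublist⇒contains p s⊆σ agree = any⁺ (pairsAgree p) (lose (⊆⇒∈-subseqs s⊆σ) agree)

pairsAgree⇒length≡ : ∀ p s → T (pairsAgree p s) → length p ≡ length s
pairsAgree⇒length≡ []      []      _     = refl
pairsAgree⇒length≡ (_ ∷ p) (_ ∷ s) agree = cong suc (pairsAgree⇒length≡ p s (proj₂ (T-∧ .to agree)))

length≡3 : ∀ (s : List ℕ) → 3 ≡ length s → ∃[ a ] ∃[ b ] ∃[ c ] s ≡ a ∷ b ∷ c ∷ []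
length≡3 (a ∷ b ∷ c ∷ []) refl = a , b , c , refl

Pattern231 Pattern312 : ℕ → ℕ → ℕ → Set
Pattern231 a b c = c < a × a < b
Pattern312 a b c = b < c × c < a

Occurrence : List ℕ → Set
Occurrence σ = ∃[ a ] ∃[ b ] ∃[ c ] (a ∷ b ∷ c ∷ []) ⊆ σ × (Pattern231 a b c ⊎ Pattern312 a b c)

occurrence-mono : ∀ {σ τ} → σ ⊆ τ → Occurrence σ → Occurrence τ
occurrence-mono σ⊆τ (a , b , c , abc⊆σ , pat) = a , b , c , ⊆-trans abc⊆σ σ⊆τ , pat

pairsAgree-231⇒ : ∀ a b c → T (pairsAgree pat231 (a ∷ b ∷ c ∷ [])) → Pattern231 a b c
pairsAgree-231⇒ a b c agree with a <ᵇ b in a<b | b <ᵇ a | a <ᵇ c | c <ᵇ a in c<a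
... | true | false | false | true = <ᵇ≡true⇒< c<a , <ᵇ≡true⇒< a<b

pairsAgree-312⇒ : ∀ a b c → T (pairsAgree pat312 (a ∷ b ∷ c ∷ [])) → Pattern312 a b c
pairsAgree-312⇒ a b c agree with a <ᵇ b | b <ᵇ a | a <ᵇ c | c <ᵇ a in c<a | b <ᵇ c in b<c
... | false | true | false | true | true = <ᵇ≡true⇒< b<c , <ᵇ≡true⇒< c<a

pairsAgree-231⇐ : ∀ a b c → Pattern231 a b c → T (pairsAgree pat231 (a ∷ b ∷ c ∷ []))
pairsAgree-231⇐ a b c (c<a , a<b) rewrite <⇒<ᵇ≡true a<b | <⇒>ᵇ≡false a<b
  | <⇒<ᵇ≡true c<a | <⇒>ᵇ≡false c<a
  | <⇒<ᵇ≡true (ℕ.<-trans c<a a<b) | <⇒>ᵇ≡false (ℕ.<-trans c<a a<b) = tt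

pairsAgree-312⇐ : ∀ a b c → Pattern312 a b c → T (pairsAgree pat312 (a ∷ b ∷ c ∷ []))
pairsAgree-312⇐ a b c (b<c , c<a) rewrite <⇒<ᵇ≡true b<c | <⇒>ᵇ≡false b<c
  | <⇒<ᵇ≡true c<a | <⇒>ᵇ≡false c<a
  | <⇒<ᵇ≡true (ℕ.<-trans b<c c<a) | <⇒>ᵇ≡false (ℕ.<-trans b<c c<a) = tt

avoids : List ℕ → Bool
avoids = avoidsAll (pat231 ∷ pat312 ∷ [])

occurrence⇒¬avoids : ∀ {σ} → Occurrence σ → ¬ T (avoids σ)
occurrence⇒¬avoids {σ} (a , b , c , abc⊆σ , inj₁ pat)
  with contains pat231 σ | sublist⇒contains pat231 abc⊆σ (pairsAgree-231⇐ a b c pat)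
... | true | _ = λ ()
occurrence⇒¬avoids {σ} (a , b , c , abc⊆σ , inj₂ pat)
  with contains pat231 σ | contains pat312 σ | sublist⇒contains pat312 abc⊆σ (pairsAgree-312⇐ a b c pat)
... | true  | _    | _ = λ ()
... | false | true | _ = λ ()

containsTriple : ∀ {x y z} σ → T (contains (x ∷ y ∷ z ∷ []) σ) →
  ∃[ a ] ∃[ b ] ∃[ c ] (a ∷ b ∷ c ∷ []) ⊆ σ × T (pairsAgree (x ∷ y ∷ z ∷ []) (a ∷ b ∷ c ∷ []))
containsTriple {x} {y} {z} σ has with contains⇒sublist (x ∷ y ∷ z ∷ []) σ has
... | s , s⊆σ , agree with length≡3 s (pairsAgree⇒length≡ _ s agree)
...   | a , b , c , refl = a , b , c , s⊆σ , agree

¬avoids⇒occurrence : ∀ σ → ¬ T (avoids σ) → Occurrence σ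
¬avoids⇒occurrence σ ¬av with contains pat231 σ in has231 | contains pat312 σ in has312
... | true | _ with containsTriple σ (subst T (sym has231) tt)
...   | a , b , c , abc⊆σ , agree = a , b , c , abc⊆σ , inj₁ (pairsAgree-231⇒ a b c agree)
¬avoids⇒occurrence σ ¬av | false | true with containsTriple σ (subst T (sym has312) tt)
...   | a , b , c , abc⊆σ , agree = a , b , c , abc⊆σ , inj₂ (pairsAgree-312⇒ a b c agree)
¬avoids⇒occurrence σ ¬av | false | false = ⊥-elim (¬av tt)

-- Layered permutations

_≪_ : List ℕ → List ℕ → Set
xs ≪ ys = All (λ x → All (x <_) ys) xs

≪-resp-⊆ : ∀ {xs ys us vs} → us ⊆ xs → vs ⊆ ys → xs ≪ ys → us ≪ vs
≪-resp-⊆ us⊆xs vs⊆ys xs≪ys = All-resp-⊆ us⊆xs (All.map (All-resp-⊆ vs⊆ys) xs≪ys)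

AllPairs-resp-⊆ : ∀ {R : ℕ → ℕ → Set} {xs ys : List ℕ} → xs ⊆ ys → AllPairs R ys → AllPairs R xs
AllPairs-resp-⊆ []          []           = []
AllPairs-resp-⊆ (_ ∷ʳ xs⊆ys) (_ ∷ Rys)    = AllPairs-resp-⊆ xs⊆ys Rys
AllPairs-resp-⊆ (refl ∷ xs⊆ys) (Ry ∷ Rys) = All-resp-⊆ xs⊆ys Ry ∷ AllPairs-resp-⊆ xs⊆ys Rys

⊆-++⁻ : ∀ {s : List ℕ} xs {ys} → s ⊆ xs ++ ys → ∃[ s₁ ] ∃[ s₂ ] s ≡ s₁ ++ s₂ × s₁ ⊆ xs × s₂ ⊆ ys
⊆-++⁻ []       s⊆ys = [] , _ , refl , [] , s⊆ys
⊆-++⁻ (x ∷ xs) (.x ∷ʳ s⊆) with ⊆-++⁻ xs s⊆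
... | s₁ , s₂ , refl , s₁⊆ , s₂⊆ = s₁ , s₂ , refl , x ∷ʳ s₁⊆ , s₂⊆
⊆-++⁻ (x ∷ xs) (refl ∷ s⊆) with ⊆-++⁻ xs s⊆
... | s₁ , s₂ , refl , s₁⊆ , s₂⊆ = x ∷ s₁ , s₂ , refl , refl ∷ s₁⊆ , s₂⊆

data Layered : List ℕ → Set where
  []    : Layered []
  block : ∀ {B R} → AllPairs _>_ B → B ≪ R → Layered R → Layered (B ++ R)

Layered⇒¬occurrence : ∀ {σ} → Layered σ → ¬ Occurrence σ
Layered⇒¬occurrence [] (_ , _ , _ , () , _)
Layered⇒¬occurrence (block {B} B↓ B≪R R-layered) (a , b , c , abc⊆ , pat) with ⊆-++⁻ B abc⊆
... | [] , _ , refl , _ , abc⊆R = Layered⇒¬occurrence R-layered (a , b , c , abc⊆R , pat)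
... | _ ∷ [] , _ , refl , a⊆B , bc⊆R with ≪-resp-⊆ a⊆B bc⊆R B≪R
...   | (_ ∷ a<c ∷ []) ∷ [] = case pat of λ
        { (inj₁ (c<a , _)) → ℕ.<-asym a<c c<a ; (inj₂ (_ , c<a)) → ℕ.<-asym a<c c<a }
Layered⇒¬occurrence (block B↓ B≪R _) (a , b , c , abc⊆ , pat)
  | _ ∷ _ ∷ [] , _ , refl , ab⊆B , c⊆R
  with AllPairs-resp-⊆ ab⊆B B↓ | ≪-resp-⊆ ab⊆B c⊆R B≪R
... | (b<a ∷ []) ∷ _ | ((a<c ∷ []) ∷ _) = case pat of λ
        { (inj₁ (_ , a<b)) → ℕ.<-asym a<b b<a ; (inj₂ (_ , c<a)) → ℕ.<-asym a<c c<a }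
Layered⇒¬occurrence (block B↓ _ _) (a , b , c , abc⊆ , pat)
  | _ ∷ _ ∷ _ ∷ [] , [] , refl , abc⊆B , _ with AllPairs-resp-⊆ abc⊆B B↓
... | (b<a ∷ _) ∷ (c<b ∷ []) ∷ _ = case pat of λ
        { (inj₁ (_ , a<b)) → ℕ.<-asym a<b b<a ; (inj₂ (b<c , _)) → ℕ.<-asym b<c c<b }
Layered⇒¬occurrence (block _ _ _) (_ , _ , _ , _ , _) | _ ∷ _ ∷ _ ∷ [] , _ ∷ _ , () , _ , _
Layered⇒¬occurrence (block _ _ _) (_ , _ , _ , _ , _) | _ ∷ _ ∷ _ ∷ _ ∷ _ , _ , () , _ , _

Layered⇒avoids : ∀ {σ} → Layered σ → T (avoids σ)
Layered⇒avoids {σ} σ-layered =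
  decidable-stable (T? (avoids σ)) (λ ¬av → Layered⇒¬occurrence σ-layered (¬avoids⇒occurrence σ ¬av))

++≡++-cases : ∀ (A P : List ℕ) {B R} → A ++ B ≡ P ++ R →
  (∃[ M ] A ≡ P ++ M × R ≡ M ++ B) ⊎ (∃[ m ] ∃[ M ] P ≡ A ++ m ∷ M × B ≡ m ∷ M ++ R)
++≡++-cases []      []      eq = inj₁ ([] , refl , sym eq)
++≡++-cases []      (p ∷ P) eq = inj₂ (p , P , refl , eq)
++≡++-cases (a ∷ A) []      eq = inj₁ (a ∷ A , refl , sym eq)
++≡++-cases (a ∷ A) (p ∷ P) eq with List.∷-injective eq
... | refl , eq′ with ++≡++-cases A P eq′
...   | inj₁ (M , refl , R≡) = inj₁ (M , refl , R≡)
...   | inj₂ (m , M , refl , B≡) = inj₂ (m , M , refl , B≡)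

AscentsCut : List ℕ → Set
AscentsCut σ = ∀ A a c C → σ ≡ A ++ a ∷ c ∷ C → ¬ c < a → (A ++ a ∷ []) ≪ (c ∷ C)

Layered⇒AscentsCut : ∀ {σ} → Layered σ → AscentsCut σ
Layered⇒AscentsCut [] [] _ _ _ ()
Layered⇒AscentsCut [] (_ ∷ _) _ _ _ ()
Layered⇒AscentsCut (block {B} B↓ B≪R R-layered) A a c C eq c≮a
  with ++≡++-cases A B (sym eq)
... | inj₁ (M , refl , refl) = subst (_≪ (c ∷ C)) (sym (List.++-assoc B M (a ∷ [])))
        (All.++⁺ (All.map (All.++⁻ʳ (M ++ a ∷ [])) B≪R′) (Layered⇒AscentsCut R-layered M a c C refl c≮a))
  where
  B≪R′ : B ≪ ((M ++ a ∷ []) ++ c ∷ C)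
  B≪R′ = subst (B ≪_) (sym (List.++-assoc M (a ∷ []) (c ∷ C))) B≪R
... | inj₂ (.a , [] , refl , refl) = B≪R
... | inj₂ (.a , .c ∷ M , refl , refl)
  with AllPairs-resp-⊆ (++⁺ˡ A (refl ∷ refl ∷ minimum M)) B↓
...   | (c<a ∷ []) ∷ _ = ⊥-elim (c≮a c<a)

AscentsCut-++ˡ : ∀ X {Y} → AscentsCut (X ++ Y) → AscentsCut X
AscentsCut-++ˡ X {Y} cut A a c C refl c≮a =
  All.map (All.++⁻ˡ (c ∷ C)) (cut A a c (C ++ Y) (List.++-assoc A (a ∷ c ∷ C) Y) c≮a)

AscentsCut-++ʳ : ∀ X {Y} → AscentsCut (X ++ Y) → AscentsCut Y
AscentsCut-++ʳ X cut A a c C refl c≮a = All.++⁻ʳ X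
  (subst (_≪ (c ∷ C)) (List.++-assoc X A (a ∷ []))
    (cut (X ++ A) a c C (sym (List.++-assoc X A (a ∷ c ∷ C))) c≮a))

-- The layered permutation with a prescribed descent word

-- A true bit (a descent) puts n at the end of the first block built from the rest of
-- the word, a false bit makes n a block of its own.
blockTop : ℕ → List Bool → ℕ
blockTop n []          = n
blockTop n (false ∷ _) = n
blockTop n (true ∷ b)  = blockTop (suc n) b

blockBelowTop : ℕ → List Bool → List ℕ
blockBelowTop n []          = []
blockBelowTop n (false ∷ _) = []
blockBelowTop n (true ∷ b)  = blockBelowTop (suc n) b ++ n ∷ []

firstBlock : ℕ → List Bool → List ℕ
firstBlock n b = blockTop n b ∷ blockBelowTop n b

laterBlocks : ℕ → List Bool → List ℕ
laterBlocks n []          = []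
laterBlocks n (false ∷ b) = firstBlock (suc n) b ++ laterBlocks (suc n) b
laterBlocks n (true ∷ b)  = laterBlocks (suc n) b

layeredPerm : ℕ → List Bool → List ℕ
layeredPerm n b = firstBlock n b ++ laterBlocks n b

firstBlock-≥ : ∀ n b → All (n ≤_) (firstBlock n b)
firstBlock-≥ n []          = ℕ.≤-refl ∷ []
firstBlock-≥ n (false ∷ b) = ℕ.≤-refl ∷ []
firstBlock-≥ n (true ∷ b)  = All.++⁺ (All.map ℕ.<⇒≤ (firstBlock-≥ (suc n) b)) (ℕ.≤-refl ∷ [])

laterBlocks-≥ : ∀ n b → All (n ≤_) (laterBlocks n b)
laterBlocks-≥ n []          = []
laterBlocks-≥ n (false ∷ b) = All.map ℕ.<⇒≤ (All.++⁺ (firstBlock-≥ (suc n) b) (laterBlocks-≥ (suc n) b))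
laterBlocks-≥ n (true ∷ b)  = All.map ℕ.<⇒≤ (laterBlocks-≥ (suc n) b)

firstBlock-decreasing : ∀ n b → AllPairs _>_ (firstBlock n b)
firstBlock-decreasing n []          = [] ∷ []
firstBlock-decreasing n (false ∷ b) = [] ∷ []
firstBlock-decreasing n (true ∷ b)  =
  AllPairs.++⁺ (firstBlock-decreasing (suc n) b) ([] ∷ []) (All.map (_∷ []) (firstBlock-≥ (suc n) b))

firstBlock≪laterBlocks : ∀ n b → firstBlock n b ≪ laterBlocks n b
firstBlock≪laterBlocks n []          = [] ∷ []
firstBlock≪laterBlocks n (false ∷ b) = All.++⁺ (firstBlock-≥ (suc n) b) (laterBlocks-≥ (suc n) b) ∷ []
firstBlock≪laterBlocks n (true ∷ b)  =
  All.++⁺ (firstBlock≪laterBlocks (suc n) b) (laterBlocks-≥ (suc n) b ∷ [])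

laterBlocks-layered : ∀ n b → Layered (laterBlocks n b)
laterBlocks-layered n []          = []
laterBlocks-layered n (false ∷ b) =
  block (firstBlock-decreasing (suc n) b) (firstBlock≪laterBlocks (suc n) b) (laterBlocks-layered (suc n) b)
laterBlocks-layered n (true ∷ b)  = laterBlocks-layered (suc n) b

layeredPerm-layered : ∀ n b → Layered (layeredPerm n b)
layeredPerm-layered n b = block (firstBlock-decreasing n b) (firstBlock≪laterBlocks n b) (laterBlocks-layered n b)

layeredPerm-true : ∀ n b → layeredPerm n (true ∷ b) ≡ firstBlock (suc n) b ++ n ∷ laterBlocks (suc n) b
layeredPerm-true n b = List.++-assoc (firstBlock (suc n) b) (n ∷ []) (laterBlocks (suc n) b)

length-layeredPerm : ∀ n b → length (layeredPerm n b) ≡ suc (length b)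
length-layeredPerm n []          = refl
length-layeredPerm n (false ∷ b) = cong suc (length-layeredPerm (suc n) b)
length-layeredPerm n (true ∷ b)  = begin
  length (layeredPerm n (true ∷ b))                                ≡⟨ cong length (layeredPerm-true n b) ⟩
  length (firstBlock (suc n) b ++ n ∷ laterBlocks (suc n) b)       ≡⟨ List.length-++-sucʳ (firstBlock (suc n) b) n _ ⟩
  suc (length (layeredPerm (suc n) b))                             ≡⟨ cong suc (length-layeredPerm (suc n) b) ⟩
  suc (length (true ∷ b))                                          ∎
  where open ≡-Reasoning

descentBits : List ℕ → List Bool
descentBits (a ∷ c ∷ σ) = (c <ᵇ a) ∷ descentBits (c ∷ σ)
descentBits _           = []

trues : List Bool → ℕ
trues []          = 0
trues (true ∷ b)  = suc (trues b)
trues (false ∷ b) = trues b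

des≡trues-descentBits : ∀ σ → des σ ≡ trues (descentBits σ)
des≡trues-descentBits []          = refl
des≡trues-descentBits (a ∷ [])    = refl
des≡trues-descentBits (a ∷ c ∷ σ) =
  trans (cong ((if c <ᵇ a then 1 else 0) ℕ.+_) (des≡trues-descentBits (c ∷ σ))) (trues-∷ (c <ᵇ a) _)
  where
  trues-∷ : ∀ x bs → (if x then 1 else 0) ℕ.+ trues bs ≡ trues (x ∷ bs)
  trues-∷ true  _ = refl
  trues-∷ false _ = refl

descentBits-insertAfterBlock : ∀ {n} d D R → AllPairs _>_ (d ∷ D) → (d ∷ D) ≪ R →
  All (n <_) (d ∷ D) → All (n <_) R →
  descentBits ((d ∷ D) ++ n ∷ R) ≡ true ∷ descentBits ((d ∷ D) ++ R)
descentBits-insertAfterBlock d [] [] _ _ (n<d ∷ _) _ rewrite <⇒<ᵇ≡true n<d = refl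
descentBits-insertAfterBlock d [] (r ∷ R) _ ((d<r ∷ _) ∷ _) (n<d ∷ _) (n<r ∷ _)
  rewrite <⇒<ᵇ≡true n<d | <⇒>ᵇ≡false n<r | <⇒>ᵇ≡false d<r = refl
descentBits-insertAfterBlock d (d′ ∷ D) R ((d′<d ∷ _) ∷ D↓) (_ ∷ D≪R) (_ ∷ n<D) n<R
  rewrite <⇒<ᵇ≡true d′<d = cong (true ∷_) (descentBits-insertAfterBlock d′ D R D↓ D≪R n<D n<R)

descentBits-layeredPerm : ∀ n b → descentBits (layeredPerm n b) ≡ b
descentBits-layeredPerm n [] = refl
descentBits-layeredPerm n (false ∷ b)
  rewrite <⇒>ᵇ≡false (All.head (firstBlock-≥ (suc n) b)) = cong (false ∷_) (descentBits-layeredPerm (suc n) b)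
descentBits-layeredPerm n (true ∷ b) = begin
  descentBits (layeredPerm n (true ∷ b))                              ≡⟨ cong descentBits (layeredPerm-true n b) ⟩
  descentBits (firstBlock (suc n) b ++ n ∷ laterBlocks (suc n) b)     ≡⟨ descentBits-insertAfterBlock _ _ _
                                                                           (firstBlock-decreasing (suc n) b)
                                                                           (firstBlock≪laterBlocks (suc n) b)
                                                                           (firstBlock-≥ (suc n) b)
                                                                           (laterBlocks-≥ (suc n) b) ⟩
  true ∷ descentBits (layeredPerm (suc n) b)                          ≡⟨ cong (true ∷_) (descentBits-layeredPerm (suc n) b) ⟩
  true ∷ b                                                            ∎
  where open ≡-Reasoning

-- The (231, 312)-avoiding permutations are exactly the layered ones

avoiders : List (List ℕ) → List (List ℕ)
avoiders = filter (T? ∘ avoids)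

insertionsBefore : ℕ → List ℕ → List (List ℕ)
insertionsBefore m []      = []
insertionsBefore m (x ∷ X) = (m ∷ x ∷ X) ∷ map (x ∷_) (insertionsBefore m X)

insertions-++ : ∀ m X Y → insertions m (X ++ Y) ≡ map (_++ Y) (insertionsBefore m X) ++ map (X ++_) (insertions m Y)
insertions-++ m []      Y = sym (List.map-id (insertions m Y))
insertions-++ m (x ∷ X) Y = cong ((m ∷ x ∷ X ++ Y) ∷_) (begin
  map (x ∷_) (insertions m (X ++ Y))
    ≡⟨ cong (map (x ∷_)) (insertions-++ m X Y) ⟩
  map (x ∷_) (map (_++ Y) (insertionsBefore m X) ++ map (X ++_) (insertions m Y))
    ≡⟨ List.map-++ (x ∷_) (map (_++ Y) (insertionsBefore m X)) _ ⟩
  map (x ∷_) (map (_++ Y) (insertionsBefore m X)) ++ map (x ∷_) (map (X ++_) (insertions m Y))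
    ≡⟨ cong₂ _++_ (trans (sym (List.map-∘ (insertionsBefore m X))) (List.map-∘ (insertionsBefore m X)))
                  (sym (List.map-∘ (insertions m Y))) ⟩
  map (_++ Y) (map (x ∷_) (insertionsBefore m X)) ++ map ((x ∷ X) ++_) (insertions m Y) ∎)
  where open ≡-Reasoning

insertions-⊇ : ∀ m σ → All (σ ⊆_) (insertions m σ)
insertions-⊇ m []      = (m ∷ʳ []) ∷ []
insertions-⊇ m (a ∷ σ) = (m ∷ʳ ⊆-refl) ∷ All.map⁺ (All.map (refl ∷_) (insertions-⊇ m σ))

insertions-∋ : ∀ m σ → All (m ∈_) (insertions m σ)
insertions-∋ m []      = here refl ∷ []
insertions-∋ m (a ∷ σ) = here refl ∷ All.map⁺ (All.map there (insertions-∋ m σ))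

length-insertions : ∀ a σ → All (λ τ → length τ ≡ suc (length σ)) (insertions a σ)
length-insertions a []      = refl ∷ []
length-insertions a (b ∷ σ) = refl ∷ All.map⁺ (All.map (cong suc) (length-insertions a σ))

length-perms : ∀ L → All (λ σ → length σ ≡ length L) (perms L)
length-perms []      = refl ∷ []
length-perms (a ∷ L) = All.concat⁺ (All.map⁺ (All.map
  (λ {σ} |σ| → All.map (λ |τ| → trans |τ| (cong suc |σ|)) (length-insertions a σ)) (length-perms L)))

¬avoids-insertions : ∀ m σ → ¬ T (avoids σ) → All (λ τ → ¬ T (avoids τ)) (insertions m σ)
¬avoids-insertions m σ ¬av = All.map (λ σ⊆τ → occurrence⇒¬avoids (occurrence-mono σ⊆τ (¬avoids⇒occurrence σ ¬av)))
                                     (insertions-⊇ m σ)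

avoiders-insertions-block : ∀ {m d} D R → AllPairs _>_ (d ∷ D) → (d ∷ D) ≪ R → All (m <_) (d ∷ D) →
  T (avoids (m ∷ (d ∷ D) ++ R)) → T (avoids ((d ∷ D) ++ m ∷ R)) →
  avoiders (insertions m ((d ∷ D) ++ R)) ≡ (m ∷ (d ∷ D) ++ R) ∷ ((d ∷ D) ++ m ∷ R) ∷ []
avoiders-insertions-block {m} {d} D R (D<d ∷ _) (d<R ∷ _) (m<d ∷ m<D) avoidsFront avoidsAfter = begin
  avoiders (insertions m ((d ∷ D) ++ R))
    ≡⟨ cong avoiders (insertions-++ m (d ∷ D) R) ⟩
  avoiders ((m ∷ (d ∷ D) ++ R) ∷ map (_++ R) (map (d ∷_) (insertionsBefore m D)) ++ map ((d ∷ D) ++_) (insertions m R))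
    ≡⟨ List.filter-accept (T? ∘ avoids) avoidsFront ⟩
  (m ∷ (d ∷ D) ++ R) ∷ avoiders (map (_++ R) (map (d ∷_) (insertionsBefore m D)) ++ map ((d ∷ D) ++_) (insertions m R))
    ≡⟨ cong ((m ∷ (d ∷ D) ++ R) ∷_) (List.filter-++ (T? ∘ avoids) (map (_++ R) (map (d ∷_) (insertionsBefore m D))) _) ⟩
  (m ∷ (d ∷ D) ++ R) ∷ avoiders (map (_++ R) (map (d ∷_) (insertionsBefore m D))) ++ avoiders (map ((d ∷ D) ++_) (insertions m R))
    ≡⟨ cong ((m ∷ (d ∷ D) ++ R) ∷_) (cong₂ _++_ insideBlock (afterBlock R d<R avoidsAfter)) ⟩
  (m ∷ (d ∷ D) ++ R) ∷ ((d ∷ D) ++ m ∷ R) ∷ [] ∎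
  where
  open ≡-Reasoning
  -- m inserted before some x of D: d m x is a 312
  occurs-insideBlock : ∀ X → All (λ x → m < x × x < d) X → All (λ τ → Occurrence (d ∷ τ ++ R)) (insertionsBefore m X)
  occurs-insideBlock []      _                  = []
  occurs-insideBlock (x ∷ X) ((m<x , x<d) ∷ m<X<d) =
    (d , m , x , refl ∷ refl ∷ refl ∷ minimum _ , inj₂ (m<x , x<d))
    ∷ All.map⁺ (All.map (occurrence-mono (refl ∷ (x ∷ʳ ⊆-refl))) (occurs-insideBlock X m<X<d))
  insideBlock : avoiders (map (_++ R) (map (d ∷_) (insertionsBefore m D))) ≡ []
  insideBlock = List.filter-none (T? ∘ avoids) (All.map⁺ (All.map⁺ (All.map occurrence⇒¬avoids
                  (occurs-insideBlock D (All.zip (m<D , D<d))))))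
  -- m inserted after some r of R: d r m is a 231
  afterBlock : ∀ R → All (d <_) R → T (avoids ((d ∷ D) ++ m ∷ R)) →
    avoiders (map ((d ∷ D) ++_) (insertions m R)) ≡ ((d ∷ D) ++ m ∷ R) ∷ []
  afterBlock []       _         avoids-after = List.filter-accept (T? ∘ avoids) avoids-after
  afterBlock (r ∷ R′) (d<r ∷ _) avoids-after = trans (List.filter-accept (T? ∘ avoids) avoids-after)
    (cong (((d ∷ D) ++ m ∷ r ∷ R′) ∷_) (List.filter-none (T? ∘ avoids) (All.map⁺ (All.map⁺
      (All.map (λ m∈τ → occurrence⇒¬avoids (d , r , m , refl ∷ ++⁺ˡ D (refl ∷ from∈ m∈τ) , inj₁ (m<d , d<r)))
               (insertions-∋ m R′))))))

avoiders-insertions-layeredPerm : ∀ m b →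
  avoiders (insertions m (layeredPerm (suc m) b)) ≡ layeredPerm m (false ∷ b) ∷ layeredPerm m (true ∷ b) ∷ []
avoiders-insertions-layeredPerm m b = begin
  avoiders (insertions m (layeredPerm (suc m) b))
    ≡⟨ avoiders-insertions-block (blockBelowTop (suc m) b) (laterBlocks (suc m) b)
         (firstBlock-decreasing (suc m) b) (firstBlock≪laterBlocks (suc m) b) (firstBlock-≥ (suc m) b)
         (Layered⇒avoids (layeredPerm-layered m (false ∷ b)))
         (subst (T ∘ avoids) (layeredPerm-true m b) (Layered⇒avoids (layeredPerm-layered m (true ∷ b)))) ⟩
  layeredPerm m (false ∷ b) ∷ (firstBlock (suc m) b ++ m ∷ laterBlocks (suc m) b) ∷ []
    ≡⟨ cong (λ σ → layeredPerm m (false ∷ b) ∷ σ ∷ []) (sym (layeredPerm-true m b)) ⟩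
  layeredPerm m (false ∷ b) ∷ layeredPerm m (true ∷ b) ∷ [] ∎
  where open ≡-Reasoning

module _ {A B : Set} {P : Pred B 0ℓ} (P? : Decidable P) where

  filter-concatMap : ∀ (f : A → List B) xs → filter P? (concatMap f xs) ≡ concatMap (filter P? ∘ f) xs
  filter-concatMap f []       = refl
  filter-concatMap f (x ∷ xs) = trans (List.filter-++ P? (f x) (concatMap f xs)) (cong (filter P? (f x) ++_) (filter-concatMap f xs))

  concatMap-filter : ∀ (g : B → List A) xs → (∀ x → ¬ P x → g x ≡ []) → concatMap g xs ≡ concatMap g (filter P? xs)
  concatMap-filter g []       _    = refl
  concatMap-filter g (x ∷ xs) g≡[] with P? x
  ... | yes _  = cong (g x ++_) (concatMap-filter g xs g≡[])
  ... | no ¬px = trans (cong (_++ concatMap g xs) (g≡[] x ¬px)) (concatMap-filter g xs g≡[])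

allBits : ℕ → List (List Bool)
allBits zero    = [] ∷ []
allBits (suc k) = concatMap (λ b → (false ∷ b) ∷ (true ∷ b) ∷ []) (allBits k)

allBits-length : ∀ k → All (λ b → length b ≡ k) (allBits k)
allBits-length zero    = refl ∷ []
allBits-length (suc k) = All.concat⁺ (All.map⁺ (All.map (λ |b| → cong suc |b| ∷ cong suc |b| ∷ []) (allBits-length k)))

range : ℕ → ℕ → List ℕ
range m zero    = []
range m (suc k) = m ∷ range (suc m) k

avoiders-perms-range : ∀ k m → avoiders (perms (range m (suc k))) ≡ map (layeredPerm m) (allBits k)
avoiders-perms-range zero    m = List.filter-accept (T? ∘ avoids) {xs = []} (Layered⇒avoids (layeredPerm-layered m []))
avoiders-perms-range (suc k) m = begin
  avoiders (concatMap (insertions m) perms′)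
    ≡⟨ filter-concatMap (T? ∘ avoids) (insertions m) perms′ ⟩
  concatMap avoidingInsertions perms′
    ≡⟨ concatMap-filter (T? ∘ avoids) avoidingInsertions perms′
         (λ σ ¬av → List.filter-none (T? ∘ avoids) (¬avoids-insertions m σ ¬av)) ⟩
  concatMap avoidingInsertions (avoiders perms′)
    ≡⟨ cong (concatMap avoidingInsertions) (avoiders-perms-range k (suc m)) ⟩
  concatMap avoidingInsertions (map (layeredPerm (suc m)) (allBits k))
    ≡⟨ List.concatMap-map avoidingInsertions (layeredPerm (suc m)) (allBits k) ⟩
  concatMap (avoidingInsertions ∘ layeredPerm (suc m)) (allBits k)
    ≡⟨ List.concatMap-cong (avoiders-insertions-layeredPerm m) (allBits k) ⟩
  concatMap (λ b → map (layeredPerm m) ((false ∷ b) ∷ (true ∷ b) ∷ [])) (allBits k)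
    ≡⟨ sym (List.map-concatMap (layeredPerm m) _ (allBits k)) ⟩
  map (layeredPerm m) (allBits (suc k)) ∎
  where
  open ≡-Reasoning
  perms′ = perms (range (suc m) (suc k))
  avoidingInsertions : List ℕ → List (List ℕ)
  avoidingInsertions = avoiders ∘ insertions m

applyUpTo-range : ∀ {f : ℕ → ℕ} m k → (∀ i → f i ≡ m ℕ.+ i) → applyUpTo f k ≡ range m k
applyUpTo-range m zero    _     = refl
applyUpTo-range m (suc k) f≗m+ =
  cong₂ _∷_ (trans (f≗m+ 0) (ℕ.+-identityʳ m)) (applyUpTo-range (suc m) k (λ i → trans (f≗m+ (suc i)) (ℕ.+-suc m i)))

labels≡range : ∀ N → map suc (upTo N) ≡ range 1 N
labels≡range N = trans (List.map-applyUpTo id suc N) (applyUpTo-range 1 N (λ _ → refl))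

-- Diamond conditions as a descent mask

splitAtLength : ∀ v {w} (σ : List ℕ) → length σ ≡ v ℕ.+ w → ∃[ B ] ∃[ C ] σ ≡ B ++ C × length B ≡ v × length C ≡ w
splitAtLength zero    σ       |σ| = [] , σ , refl , refl , |σ|
splitAtLength (suc v) (x ∷ σ) |σ| with splitAtLength v σ (ℕ.suc-injective |σ|)
... | B , C , refl , |B| , |C| = x ∷ B , C , refl , cong suc |B| , |C|

blocks-++ : ∀ {v} d (B C : List ℕ) → length B ≡ v → blocks v (suc d) (B ++ C) ≡ B ∷ blocks v d C
blocks-++ d B C refl = cong₂ (λ B′ C′ → B′ ∷ blocks (length B) d C′) (take-length-++ B) (drop-length-++ B)
  where
  take-length-++ : ∀ B → take (length B) (B ++ C) ≡ B
  take-length-++ []      = refl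
  take-length-++ (x ∷ B) = cong (x ∷_) (take-length-++ B)
  drop-length-++ : ∀ B → drop (length B) (B ++ C) ≡ C
  drop-length-++ []      = refl
  drop-length-++ (x ∷ B) = drop-length-++ B

concat-blocks : ∀ v d (σ : List ℕ) → length σ ≡ v ℕ.* d → concat (blocks v d σ) ≡ σ
concat-blocks v zero    []      _   = refl
concat-blocks v zero    (_ ∷ _) |σ| with trans |σ| (ℕ.*-zeroʳ v)
... | ()
concat-blocks v (suc d) σ       |σ| with splitAtLength v σ (trans |σ| (ℕ.*-suc v d))
... | B , C , refl , refl , |C| = trans (cong concat (blocks-++ d B C refl)) (cong (B ++_) (concat-blocks (length B) d C |C|))

respects : (mask bits : List Bool) → Bool
respects (m ∷ ms) (x ∷ xs) = (m ∨ not x) ∧ respects ms xs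
respects _        _        = true

respects-++ : ∀ ms {ms′} xs {xs′} → length ms ≡ length xs →
  respects (ms ++ ms′) (xs ++ xs′) ≡ respects ms xs ∧ respects ms′ xs′
respects-++ []       []       _   = refl
respects-++ (m ∷ ms) (x ∷ xs) |ms| =
  trans (cong ((m ∨ not x) ∧_) (respects-++ ms xs (ℕ.suc-injective |ms|))) (sym (∧-assoc (m ∨ not x) _ _))

-- Where π_D may descend: inside a diamond only between two middle elements, and
-- anywhere between consecutive diamonds.
diamondMask : ℕ → List Bool
diamondMask k = false ∷ replicate k true ++ false ∷ []

diamondsMask : ℕ → ℕ → List Bool
diamondsMask k zero    = diamondMask k
diamondsMask k (suc d) = diamondMask k ++ true ∷ diamondsMask k d

length-diamondMask : ∀ k → length (diamondMask k) ≡ 2 ℕ.+ k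
length-diamondMask zero    = refl
length-diamondMask (suc k) = cong suc (length-diamondMask k)

suc-length-diamondsMask : ∀ k d → suc (length (diamondsMask k d)) ≡ (3 ℕ.+ k) ℕ.* suc d
suc-length-diamondsMask k zero    = trans (cong suc (length-diamondMask k)) (sym (ℕ.*-identityʳ (3 ℕ.+ k)))
suc-length-diamondsMask k (suc d) = begin
  suc (length (diamondMask k ++ true ∷ diamondsMask k d))
    ≡⟨ cong suc (List.length-++ (diamondMask k)) ⟩
  suc (length (diamondMask k) ℕ.+ suc (length (diamondsMask k d)))
    ≡⟨ cong₂ (λ a b → suc (a ℕ.+ b)) (length-diamondMask k) (suc-length-diamondsMask k d) ⟩
  (3 ℕ.+ k) ℕ.+ (3 ℕ.+ k) ℕ.* suc d
    ≡⟨ sym (ℕ.*-suc (3 ℕ.+ k) (suc d)) ⟩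
  (3 ℕ.+ k) ℕ.* suc (suc d) ∎
  where open ≡-Reasoning

trues-++ : ∀ a b → trues (a ++ b) ≡ trues a ℕ.+ trues b
trues-++ []          b = refl
trues-++ (true ∷ a)  b = cong suc (trues-++ a b)
trues-++ (false ∷ a) b = trues-++ a b

trues-diamondMask : ∀ k → trues (diamondMask k) ≡ k
trues-diamondMask zero    = refl
trues-diamondMask (suc k) = cong suc (trues-diamondMask k)

respects-diamondMask : ∀ x ys y {k} → length ys ≡ k → respects (diamondMask k) (x ∷ ys ++ y ∷ []) ≡ not x ∧ not y
respects-diamondMask x ys y refl = cong (not x ∧_) (middleFree ys)
  where
  middleFree : ∀ ys → respects (replicate (length ys) true ++ false ∷ []) (ys ++ y ∷ []) ≡ not y
  middleFree []       = ∧-identityʳ (not y)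
  middleFree (_ ∷ ys) = middleFree ys

descentBits-++ : ∀ b B c C →
  descentBits ((b ∷ B) ++ c ∷ C) ≡ descentBits (b ∷ B) ++ (c <ᵇ lastOr b B) ∷ descentBits (c ∷ C)
descentBits-++ b []       c C = refl
descentBits-++ b (b′ ∷ B) c C = cong ((b′ <ᵇ b) ∷_) (descentBits-++ b′ B c C)

length-descentBits : ∀ b B → length (descentBits (b ∷ B)) ≡ length B
length-descentBits b []       = refl
length-descentBits b (b′ ∷ B) = cong suc (length-descentBits b′ B)

lastOr-∷ʳ : ∀ a xs g → lastOr a (xs ++ g ∷ []) ≡ g
lastOr-∷ʳ a []       g = refl
lastOr-∷ʳ a (x ∷ xs) g = lastOr-∷ʳ x xs g

initL-∷ʳ : ∀ xs g → initL (xs ++ g ∷ []) ≡ xs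
initL-∷ʳ []           g = refl
initL-∷ʳ (x ∷ [])     g = refl
initL-∷ʳ (x ∷ y ∷ xs) g = cong (x ∷_) (initL-∷ʳ (y ∷ xs) g)

initL++lastOr : ∀ m ms → initL (m ∷ ms) ++ lastOr m ms ∷ [] ≡ m ∷ ms
initL++lastOr m []       = refl
initL++lastOr m (m′ ∷ ms) = cong (m ∷_) (initL++lastOr m′ ms)

lastOr∈ : ∀ m ms → lastOr m ms ∈ m ∷ ms
lastOr∈ m []        = here refl
lastOr∈ m (m′ ∷ ms) = there (lastOr∈ m′ ms)

validDiamond-ascentsCut : ∀ lo m ms g → AscentsCut (lo ∷ m ∷ ms ++ g ∷ []) →
  validDiamond (lo ∷ m ∷ ms ++ g ∷ []) ≡ not (m <ᵇ lo) ∧ not (g <ᵇ lastOr m ms)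
validDiamond-ascentsCut lo m ms g cut rewrite lastOr-∷ʳ m ms g | initL-∷ʳ (m ∷ ms) g = T⇔T⇒≡ valid⇒ ⇒valid
  where
  inside : ℕ → Bool
  inside x = (lo <ᵇ x) ∧ (x <ᵇ g)
  valid⇒ : T (and (map inside (m ∷ ms)) ∧ (lo <ᵇ g)) → T (not (m <ᵇ lo) ∧ not (g <ᵇ lastOr m ms))
  valid⇒ valid with All.all⁺ inside (m ∷ ms) (proj₁ (T-∧ .to valid))
  ... | middleInside rewrite <⇒>ᵇ≡false (ℕ.<ᵇ⇒< lo m (proj₁ (T-∧ .to (All.head middleInside))))
    | <⇒>ᵇ≡false (ℕ.<ᵇ⇒< (lastOr m ms) g (proj₂ (T-∧ .to (All.lookup middleInside (lastOr∈ m ms))))) = tt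
  ⇒valid : T (not (m <ᵇ lo) ∧ not (g <ᵇ lastOr m ms)) → T (and (map inside (m ∷ ms)) ∧ (lo <ᵇ g))
  ⇒valid bits = T-∧ .from (All.all⁻ inside (All.zipWith (λ (lo<x , x<g) → T-∧ .from (ℕ.<⇒<ᵇ lo<x , ℕ.<⇒<ᵇ x<g))
                  (All.++⁻ˡ (m ∷ ms) lo< , All.tail below-g)) , ℕ.<⇒<ᵇ (All.head below-g))
    where
    lo< : All (lo <_) (m ∷ ms ++ g ∷ [])
    lo< = All.head (cut [] lo m (ms ++ g ∷ []) refl (T-not-<ᵇ⇒≮ (proj₁ (T-∧ .to bits))))
    below-g : All (_< g) (lo ∷ m ∷ ms)
    below-g = subst (All (_< g)) (cong (lo ∷_) (initL++lastOr m ms))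
      (All.map All.head (cut (lo ∷ initL (m ∷ ms)) (lastOr m ms) g []
        (cong (lo ∷_) (trans (cong (_++ g ∷ []) (sym (initL++lastOr m ms))) (List.++-assoc (initL (m ∷ ms)) _ _)))
        (T-not-<ᵇ⇒≮ (proj₂ (T-∧ .to bits)))))

diamondShape : ∀ k (B : List ℕ) → length B ≡ 3 ℕ.+ k →
  ∃[ lo ] ∃[ m ] ∃[ ms ] ∃[ g ] B ≡ lo ∷ m ∷ ms ++ g ∷ [] × length ms ≡ k
diamondShape k (lo ∷ m ∷ rest) |B| with splitAtLength k rest (trans (ℕ.suc-injective (ℕ.suc-injective |B|)) (ℕ.+-comm 1 k))
... | ms , g ∷ [] , refl , |ms| , _ = lo , m , ms , g , refl , |ms|

validDiamond≡respects : ∀ k B → length B ≡ 3 ℕ.+ k → AscentsCut B →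
  validDiamond B ≡ respects (diamondMask k) (descentBits B)
validDiamond≡respects k B |B| cut with diamondShape k B |B|
... | lo , m , ms , g , refl , refl = begin
  validDiamond (lo ∷ m ∷ ms ++ g ∷ [])
    ≡⟨ validDiamond-ascentsCut lo m ms g cut ⟩
  not (m <ᵇ lo) ∧ not (g <ᵇ lastOr m ms)
    ≡⟨ sym (respects-diamondMask (m <ᵇ lo) (descentBits (m ∷ ms)) (g <ᵇ lastOr m ms) (length-descentBits m ms)) ⟩
  respects (diamondMask (length ms)) ((m <ᵇ lo) ∷ descentBits (m ∷ ms) ++ (g <ᵇ lastOr m ms) ∷ [])
    ≡⟨ cong (λ bits → respects (diamondMask (length ms)) ((m <ᵇ lo) ∷ bits)) (sym (descentBits-++ m ms g [])) ⟩
  respects (diamondMask (length ms)) (descentBits (lo ∷ m ∷ ms ++ g ∷ [])) ∎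
  where open ≡-Reasoning

validDiamonds≡respects : ∀ k d σ → length σ ≡ (3 ℕ.+ k) ℕ.* suc d → AscentsCut σ →
  and (map validDiamond (blocks (3 ℕ.+ k) (suc d) σ)) ≡ respects (diamondsMask k d) (descentBits σ)
validDiamonds≡respects k d σ |σ| cut with splitAtLength (3 ℕ.+ k) σ (trans |σ| (ℕ.*-suc (3 ℕ.+ k) d))
validDiamonds≡respects k zero _ _ cut | B , C , refl , |B| , |C|
  with C | trans |C| (ℕ.*-zeroʳ (3 ℕ.+ k))
... | [] | _ = begin
  and (map validDiamond (blocks (3 ℕ.+ k) 1 (B ++ [])))  ≡⟨ cong (and ∘ map validDiamond) (blocks-++ 0 B [] |B|) ⟩
  validDiamond B ∧ true                                   ≡⟨ ∧-identityʳ _ ⟩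
  validDiamond B                                          ≡⟨ validDiamond≡respects k B |B| (AscentsCut-++ˡ B cut) ⟩
  respects (diamondMask k) (descentBits B)                ≡⟨ cong (respects (diamondMask k) ∘ descentBits) (sym (List.++-identityʳ B)) ⟩
  respects (diamondMask k) (descentBits (B ++ []))        ∎
  where open ≡-Reasoning
validDiamonds≡respects k (suc d) _ _ cut | b ∷ B′ , c ∷ C′ , refl , |B| , |C| = begin
  and (map validDiamond (blocks (3 ℕ.+ k) (2 ℕ.+ d) (B ++ C)))
    ≡⟨ cong (and ∘ map validDiamond) (blocks-++ (suc d) B C |B|) ⟩
  validDiamond B ∧ and (map validDiamond (blocks (3 ℕ.+ k) (suc d) C))
    ≡⟨ cong₂ _∧_ (validDiamond≡respects k B |B| (AscentsCut-++ˡ B cut))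
                 (validDiamonds≡respects k d C |C| (AscentsCut-++ʳ B cut)) ⟩
  respects (diamondMask k) (descentBits B) ∧ respects (diamondsMask k d) (descentBits C)
    ≡⟨ sym (respects-++ (diamondMask k) (descentBits B) (sym (trans (length-descentBits b B′) |mask|))) ⟩
  respects (diamondsMask k (suc d)) (descentBits B ++ (c <ᵇ lastOr b B′) ∷ descentBits C)
    ≡⟨ cong (respects (diamondsMask k (suc d))) (sym (descentBits-++ b B′ c C′)) ⟩
  respects (diamondsMask k (suc d)) (descentBits (B ++ C)) ∎
  where
  open ≡-Reasoning
  B = b ∷ B′
  C = c ∷ C′
  |mask| : length B′ ≡ length (diamondMask k)
  |mask| = trans (ℕ.suc-injective |B|) (sym (length-diamondMask k))

-- Counting the labellings

private variable I J : Set

sumℤ : (I → ℤ) → List I → ℤ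
sumℤ f xs = foldr _+_ (+ 0) (map f xs)

infix 2 _when_
_when_ : ℤ → Bool → ℤ
a when b = if b then a else + 0

sumℤ-filter : ∀ (p : I → Bool) (f : I → ℤ) xs → sumℤ f (filter (T? ∘ p) xs) ≡ sumℤ (λ a → f a when p a) xs
sumℤ-filter p f []       = refl
sumℤ-filter p f (x ∷ xs) with p x
... | true  = cong (_+_ (f x)) (sumℤ-filter p f xs)
... | false = trans (sumℤ-filter p f xs) (sym (ℤ.+-identityˡ _))

sumℤ-map : ∀ (f : J → ℤ) (g : I → J) xs → sumℤ f (map g xs) ≡ sumℤ (f ∘ g) xs
sumℤ-map f g []       = refl
sumℤ-map f g (x ∷ xs) = cong (_+_ (f (g x))) (sumℤ-map f g xs)

sumℤ-cong : ∀ {f g : I → ℤ} {xs} → All (λ a → f a ≡ g a) xs → sumℤ f xs ≡ sumℤ g xs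
sumℤ-cong []           = refl
sumℤ-cong (fx≡gx ∷ eqs) = cong₂ _+_ fx≡gx (sumℤ-cong eqs)

sumℤ-++ : ∀ (f : I → ℤ) xs ys → sumℤ f (xs ++ ys) ≡ sumℤ f xs + sumℤ f ys
sumℤ-++ f []       ys = sym (ℤ.+-identityˡ _)
sumℤ-++ f (x ∷ xs) ys = trans (cong (_+_ (f x)) (sumℤ-++ f xs ys)) (sym (ℤ.+-assoc (f x) _ _))

sumℤ-concatMap : ∀ (f : J → ℤ) (g : I → List J) xs → sumℤ f (concatMap g xs) ≡ sumℤ (sumℤ f ∘ g) xs
sumℤ-concatMap f g []       = refl
sumℤ-concatMap f g (x ∷ xs) = trans (sumℤ-++ f (g x) (concatMap g xs)) (cong (_+_ (sumℤ f (g x))) (sumℤ-concatMap f g xs))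

sumℤ-*ˡ : ∀ c (f : I → ℤ) xs → sumℤ (λ a → c * f a) xs ≡ c * sumℤ f xs
sumℤ-*ˡ c f []       = sym (ℤ.*-zeroʳ c)
sumℤ-*ˡ c f (x ∷ xs) = trans (cong (_+_ (c * f x)) (sumℤ-*ˡ c f xs)) (sym (ℤ.*-distribˡ-+ c (f x) _))

maskedWeight : ℤ → List Bool → List Bool → ℤ
maskedWeight x M b = x ^ trues b when respects M b

sum-maskedWeight : ∀ x M → sumℤ (maskedWeight x M) (allBits (length M)) ≡ (+ 1 + x) ^ trues M
sum-maskedWeight x []      = refl
sum-maskedWeight x (t ∷ M) = begin
  sumℤ (maskedWeight x (t ∷ M)) (allBits (suc (length M)))
    ≡⟨ sumℤ-concatMap (maskedWeight x (t ∷ M)) _ (allBits (length M)) ⟩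
  sumℤ (λ b → maskedWeight x (t ∷ M) (false ∷ b) + (maskedWeight x (t ∷ M) (true ∷ b) + + 0)) (allBits (length M))
    ≡⟨ sumℤ-cong (All.universal (extendBit t) (allBits (length M))) ⟩
  sumℤ (λ b → factor t * maskedWeight x M b) (allBits (length M))
    ≡⟨ sumℤ-*ˡ (factor t) (maskedWeight x M) (allBits (length M)) ⟩
  factor t * sumℤ (maskedWeight x M) (allBits (length M))
    ≡⟨ cong (factor t *_) (sum-maskedWeight x M) ⟩
  factor t * (+ 1 + x) ^ trues M
    ≡⟨ factor-^ t ⟩
  (+ 1 + x) ^ trues (t ∷ M) ∎
  where
  open ≡-Reasoning
  factor : Bool → ℤ
  factor true  = + 1 + x
  factor false = + 1
  factor-out : ∀ y a → a + (y * a + + 0) ≡ (+ 1 + y) * a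
  factor-out = solve-∀
  extendBit : ∀ t b → maskedWeight x (t ∷ M) (false ∷ b) + (maskedWeight x (t ∷ M) (true ∷ b) + + 0)
                      ≡ factor t * maskedWeight x M b
  extendBit true b with respects M b
  ... | true  = factor-out x (x ^ trues b)
  ... | false = sym (ℤ.*-zeroʳ (+ 1 + x))
  extendBit false b with respects M b
  ... | true  = trans (ℤ.+-identityʳ (x ^ trues b)) (sym (ℤ.*-identityˡ (x ^ trues b)))
  ... | false = refl
  factor-^ : ∀ t → factor t * (+ 1 + x) ^ trues M ≡ (+ 1 + x) ^ trues (t ∷ M)
  factor-^ true  = refl
  factor-^ false = ℤ.*-identityˡ _

labellingWeight : ℕ → ℕ → ℤ → List ℕ → ℤ
labellingWeight v d x σ = x ^ des σ when and (map validDiamond (blocks v d σ))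

GF≡sum-avoiders : ∀ v d x →
  GF v x (suc d) ≡ sumℤ (labellingWeight v (suc d) x) (avoiders (perms (map suc (upTo (v ℕ.* suc d)))))
GF≡sum-avoiders v d x = begin
  sumℤ contribution (filter (T? ∘ avoids ∘ concat) (filter (T? ∘ valid) (map diamonds labellings)))
    ≡⟨ sumℤ-filter (avoids ∘ concat) contribution (filter (T? ∘ valid) (map diamonds labellings)) ⟩
  sumℤ (λ D → contribution D when avoids (concat D)) (filter (T? ∘ valid) (map diamonds labellings))
    ≡⟨ sumℤ-filter valid (λ D → contribution D when avoids (concat D)) (map diamonds labellings) ⟩
  sumℤ (λ D → (contribution D when avoids (concat D)) when valid D) (map diamonds labellings)
    ≡⟨ sumℤ-map _ diamonds labellings ⟩
  sumℤ (λ σ → (contribution (diamonds σ) when avoids (concat (diamonds σ))) when valid (diamonds σ)) labellings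
    ≡⟨ sumℤ-cong (All.map (λ {σ} |σ| → reorder σ (trans |σ| |labels|)) (length-perms (map suc (upTo N)))) ⟩
  sumℤ (λ σ → labellingWeight v (suc d) x σ when avoids σ) labellings
    ≡⟨ sym (sumℤ-filter avoids (labellingWeight v (suc d) x) labellings) ⟩
  sumℤ (labellingWeight v (suc d) x) (avoiders labellings) ∎
  where
  open ≡-Reasoning
  N = v ℕ.* suc d
  labellings = perms (map suc (upTo N))
  diamonds = blocks v (suc d)
  contribution : List (List ℕ) → ℤ
  contribution D = x ^ des (concat D)
  valid : List (List ℕ) → Bool
  valid D = and (map validDiamond D)
  |labels| : length (map suc (upTo N)) ≡ N
  |labels| = trans (List.length-map suc (upTo N)) (List.length-upTo N)
  when-comm : ∀ p q (a : ℤ) → ((a when q) when p) ≡ ((a when p) when q)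
  when-comm true  _     _ = refl
  when-comm false true  _ = refl
  when-comm false false _ = refl
  reorder : ∀ σ → length σ ≡ N →
    ((contribution (diamonds σ) when avoids (concat (diamonds σ))) when valid (diamonds σ))
    ≡ (labellingWeight v (suc d) x σ when avoids σ)
  reorder σ |σ| rewrite concat-blocks v (suc d) σ |σ| = when-comm (valid (diamonds σ)) (avoids σ) _

GF-closedForm : ∀ k d x → GF (3 ℕ.+ k) x (suc d) ≡ (+ 1 + x) ^ trues (diamondsMask k d)
GF-closedForm k d x = begin
  GF v x (suc d)
    ≡⟨ GF≡sum-avoiders v d x ⟩
  sumℤ weight (avoiders (perms (map suc (upTo (v ℕ.* suc d)))))
    ≡⟨ cong (sumℤ weight ∘ avoiders ∘ perms) (trans (labels≡range _) (cong (range 1) (sym (suc-length-diamondsMask k d)))) ⟩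
  sumℤ weight (avoiders (perms (range 1 (suc (length mask)))))
    ≡⟨ cong (sumℤ weight) (avoiders-perms-range (length mask) 1) ⟩
  sumℤ weight (map (layeredPerm 1) (allBits (length mask)))
    ≡⟨ sumℤ-map weight (layeredPerm 1) (allBits (length mask)) ⟩
  sumℤ (weight ∘ layeredPerm 1) (allBits (length mask))
    ≡⟨ sumℤ-cong (All.map (weight-layeredPerm _) (allBits-length (length mask))) ⟩
  sumℤ (maskedWeight x mask) (allBits (length mask))
    ≡⟨ sum-maskedWeight x mask ⟩
  (+ 1 + x) ^ trues mask ∎
  where
  open ≡-Reasoning
  v = 3 ℕ.+ k
  mask = diamondsMask k d
  weight = labellingWeight v (suc d) x
  weight-layeredPerm : ∀ b → length b ≡ length mask → weight (layeredPerm 1 b) ≡ maskedWeight x mask b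
  weight-layeredPerm b |b|
    rewrite validDiamonds≡respects k d (layeredPerm 1 b)
              (trans (length-layeredPerm 1 b) (trans (cong suc |b|) (suc-length-diamondsMask k d)))
              (Layered⇒AscentsCut (layeredPerm-layered 1 b))
          | des≡trues-descentBits (layeredPerm 1 b)
          | descentBits-layeredPerm 1 b = refl

GF-one : ∀ k x → GF (3 ℕ.+ k) x 1 ≡ (+ 1 + x) ^ k
GF-one k x = trans (GF-closedForm k 0 x) (cong ((+ 1 + x) ^_) (trues-diamondMask k))

GF-step : ∀ k x d → GF (3 ℕ.+ k) x (2 ℕ.+ d) ≡ (+ 1 + x) ^ suc k * GF (3 ℕ.+ k) x (suc d)
GF-step k x d = begin
  GF (3 ℕ.+ k) x (2 ℕ.+ d)                                  ≡⟨ GF-closedForm k (suc d) x ⟩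
  (+ 1 + x) ^ trues (diamondMask k ++ true ∷ diamondsMask k d)
    ≡⟨ cong ((+ 1 + x) ^_) (trues-++ (diamondMask k) (true ∷ diamondsMask k d)) ⟩
  (+ 1 + x) ^ (trues (diamondMask k) ℕ.+ suc (trues (diamondsMask k d)))
    ≡⟨ cong (λ t → (+ 1 + x) ^ (t ℕ.+ suc (trues (diamondsMask k d)))) (trues-diamondMask k) ⟩
  (+ 1 + x) ^ (k ℕ.+ suc (trues (diamondsMask k d)))
    ≡⟨ cong ((+ 1 + x) ^_) (ℕ.+-suc k _) ⟩
  (+ 1 + x) ^ (suc k ℕ.+ trues (diamondsMask k d))
    ≡⟨ ℤ.^-distribˡ-+-* (+ 1 + x) (suc k) _ ⟩
  (+ 1 + x) ^ suc k * (+ 1 + x) ^ trues (diamondsMask k d)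
    ≡⟨ cong ((+ 1 + x) ^ suc k *_) (sym (GF-closedForm k d x)) ⟩
  (+ 1 + x) ^ suc k * GF (3 ℕ.+ k) x (suc d) ∎
  where open ≡-Reasoning

-- Power series

⊛-zero : ∀ f g → (f ⊛ g) 0 ≡ f 0 * g 0
⊛-zero f g = ℤ.+-identityʳ (f 0 * g 0)

⊛-suc : ∀ f g n → (f ⊛ g) (suc n) ≡ f 0 * g (suc n) + ((f ∘ suc) ⊛ g) n
⊛-suc f g n = cong (λ xs → f 0 * g (suc n) + foldr _+_ (+ 0) xs)
  (trans (List.map-applyUpTo suc term (suc n)) (sym (List.map-applyUpTo id (term ∘ suc) (suc n))))
  where
  term : ℕ → ℤ
  term k = f k * g (suc n ∸ k)

⊛-constant : ∀ f g n → (∀ i → f (suc i) ≡ + 0) → (f ⊛ g) n ≡ f 0 * g n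
⊛-constant f g zero    _    = ⊛-zero f g
⊛-constant f g (suc n) f≡0 = begin
  (f ⊛ g) (suc n)                            ≡⟨ ⊛-suc f g n ⟩
  f 0 * g (suc n) + ((f ∘ suc) ⊛ g) n        ≡⟨ cong (_+_ (f 0 * g (suc n))) (⊛-constant (f ∘ suc) g n (f≡0 ∘ suc)) ⟩
  f 0 * g (suc n) + f 1 * g n                ≡⟨ cong (λ c → f 0 * g (suc n) + c * g n) (f≡0 0) ⟩
  f 0 * g (suc n) + + 0 * g n                ≡⟨ ℤ.+-identityʳ (f 0 * g (suc n)) ⟩
  f 0 * g (suc n)                            ∎
  where open ≡-Reasoning

constS-⊛ : ∀ a g n → (constS a ⊛ g) n ≡ a * g n
constS-⊛ a g n = ⊛-constant (constS a) g n (λ _ → refl)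

Y-⊛-suc : ∀ g n → (Y ⊛ g) (suc n) ≡ g n
Y-⊛-suc g n = begin
  (Y ⊛ g) (suc n)                    ≡⟨ ⊛-suc Y g n ⟩
  + 0 * g (suc n) + ((Y ∘ suc) ⊛ g) n  ≡⟨ ℤ.+-identityˡ _ ⟩
  ((Y ∘ suc) ⊛ g) n                  ≡⟨ ⊛-constant (Y ∘ suc) g n (λ _ → refl) ⟩
  + 1 * g n                          ≡⟨ ℤ.*-identityˡ (g n) ⟩
  g n                                ∎
  where open ≡-Reasoning

linear-0 : ∀ a b → (constS a ⊖ Y ⊛ constS b) 0 ≡ a
linear-0 a b = ℤ.+-identityʳ a

linear-1 : ∀ a b → (constS a ⊖ Y ⊛ constS b) 1 ≡ - b
linear-1 a b = trans (ℤ.+-identityˡ _) (cong -_ (Y-⊛-suc (constS b) 0))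

linear-2+ : ∀ a b i → (constS a ⊖ Y ⊛ constS b) (2 ℕ.+ i) ≡ + 0
linear-2+ a b i = trans (ℤ.+-identityˡ _) (cong -_ (Y-⊛-suc (constS b) (suc i)))

⊛-linear : ∀ f g n → (∀ i → f (2 ℕ.+ i) ≡ + 0) → (f ⊛ g) (suc n) ≡ f 0 * g (suc n) + f 1 * g n
⊛-linear f g n f≡0 = trans (⊛-suc f g n) (cong (_+_ (f 0 * g (suc n))) (⊛-constant (f ∘ suc) g n f≡0))

module _ (x : ℤ) (k : ℕ) where

  private
    y A : ℤ
    y = + 1 + x
    A = y ^ suc k
    W Q : Series
    W = constS (+ 1) ⊖ Y ⊛ constS A
    Q = constS y ⊛ W

    Q-0 : Q 0 ≡ y
    Q-0 = trans (constS-⊛ y W 0) (trans (cong (y *_) (linear-0 (+ 1) A)) (ℤ.*-identityʳ y))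

    Q-1 : Q 1 ≡ - (y * A)
    Q-1 = trans (constS-⊛ y W 1) (trans (cong (y *_) (linear-1 (+ 1) A)) (sym (ℤ.neg-distribʳ-* y A)))

    Q-2+ : ∀ i → Q (2 ℕ.+ i) ≡ + 0
    Q-2+ i = trans (constS-⊛ y W (2 ℕ.+ i)) (trans (cong (y *_) (linear-2+ (+ 1) A i)) (ℤ.*-zeroʳ y))

    first-order : ∀ x p → (+ 1 + x) * p + - ((+ 1 + x) * ((+ 1 + x) * p)) * + 1 ≡ - (x * ((+ 1 + x) * p))
    first-order = solve-∀

    cancel : ∀ y a g → y * (a * g) + - (y * a) * g ≡ - (+ 0)
    cancel = solve-∀

  series-identity : ∀ (G : Series) → G 0 ≡ + 1 → G 1 ≡ y ^ k → (∀ d → G (2 ℕ.+ d) ≡ A * G (suc d)) →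
    ∀ n → (constS y ⊛ (constS (+ 1) ⊖ Y ⊛ constS A) ⊛ G) n ≡ (constS y ⊖ Y ⊛ constS (x * A)) n
  series-identity G G0 _ _ zero = begin
    (Q ⊛ G) 0   ≡⟨ ⊛-zero Q G ⟩
    Q 0 * G 0   ≡⟨ cong₂ _*_ Q-0 G0 ⟩
    y * + 1     ≡⟨ ℤ.*-identityʳ y ⟩
    y           ≡⟨ sym (linear-0 y (x * A)) ⟩
    _           ∎
    where open ≡-Reasoning
  series-identity G G0 G1 _ (suc zero) = begin
    (Q ⊛ G) 1                    ≡⟨ ⊛-linear Q G 0 Q-2+ ⟩
    Q 0 * G 1 + Q 1 * G 0        ≡⟨ cong₂ _+_ (cong₂ _*_ Q-0 G1) (cong₂ _*_ Q-1 G0) ⟩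
    y * y ^ k + - (y * A) * + 1  ≡⟨ first-order x (y ^ k) ⟩
    - (x * A)                    ≡⟨ sym (linear-1 y (x * A)) ⟩
    _                            ∎
    where open ≡-Reasoning
  series-identity G _ _ Gstep (suc (suc m)) = begin
    (Q ⊛ G) (2 ℕ.+ m)                           ≡⟨ ⊛-linear Q G (suc m) Q-2+ ⟩
    Q 0 * G (2 ℕ.+ m) + Q 1 * G (suc m)         ≡⟨ cong₂ _+_ (cong₂ _*_ Q-0 (Gstep m)) (cong (_* G (suc m)) Q-1) ⟩
    y * (A * G (suc m)) + - (y * A) * G (suc m) ≡⟨ cancel y A (G (suc m)) ⟩
    - (+ 0)                                     ≡⟨ sym (linear-2+ y (x * A) m) ⟩
    _                                           ∎
    where open ≡-Reasoning

theorem3p10 : (v : ℕ) → 4 ≤ v → (x : ℤ) → (n : ℕ) →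
    (constS (+ 1 + x) ⊛ (constS (+ 1) ⊖ Y ⊛ constS ((+ 1 + x) ^ (v ∸ 2))) ⊛ GF v x) n
    ≡ (constS (+ 1 + x) ⊖ Y ⊛ constS (x * (+ 1 + x) ^ (v ∸ 2))) n
theorem3p10 (suc (suc (suc (suc k)))) (s≤s (s≤s (s≤s (s≤s _)))) x =
  series-identity x (suc k) (GF (4 ℕ.+ k) x) refl (GF-one (suc k) x) (GF-step (suc k) x)
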